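{- Let $k$ be a fixed positive integer and let $c:\{1,2,\dots,k\}\to\{+1,-1\}$ satisfy $c(ab)=c(a)c(b)$ for all positive integers $a,b$ with $ab\leqslant k$, and suppose $c$ is perfectly balanced, i.e. $c(1)+c(2)+\cdots+c(k)\in\{ -1,0,+1\}$. Then $c$ can be extended to a completely multiplicative function $c:\mathbb{N}\to\{+1,-1\}$ (i.e. $c(ab)=c(a)c(b)$ for all $a,b\in\mathbb{N}$) such that for every $s\in\mathbb{N}$ the coloring is perfectly balanced on $A_{s,k}=\{s,2s,\dots,ks\}$, i.e. $\sum_{j=1}^{k}c(js)\in\{ -1,0,+1\}$.
   Context: $\mathbb{N}=\{1,2,3,\dots\}$. Values $+1$ and $-1$ are interpreted as the colors red and blue; a coloring of a finite set is perfectly balanced if the numbers of elements of each color differ by at most one. -}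

module Defs where

open import Data.Nat using (ℕ; zero; suc; _≤_) renaming (_*_ to _*ℕ_)
open import Data.Integer using (ℤ; +_; -_; _+_; _*_)
open import Data.Sum using (_⊎_)
open import Relation.Binary.PropositionalEquality using (_≡_)

IsColour : ℤ → Set
IsColour x = x ≡ + 1 ⊎ x ≡ - (+ 1)

sumTo : (ℕ → ℤ) → ℕ → ℤ
sumTo f zero = + 0
sumTo f (suc k) = sumTo f k + f (suc k)

InMinusOneZeroOne : ℤ → Set
InMinusOneZeroOne x = x ≡ - (+ 1) ⊎ x ≡ + 0 ⊎ x ≡ + 1

PerfectlyBalanced : (ℕ → ℤ) → ℕ → Set
PerfectlyBalanced f k = InMinusOneZeroOne (sumTo f k)

-- c : {1..k} → {±1}, represented as a function on ℕ whose values outside 1..k are irrelevant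
PartialColouring : ℕ → (ℕ → ℤ) → Set
PartialColouring k c = ∀ a → 1 ≤ a → a ≤ k → IsColour (c a)

MultiplicativeUpTo : ℕ → (ℕ → ℤ) → Set
MultiplicativeUpTo k c = ∀ a b → 1 ≤ a → 1 ≤ b → a *ℕ b ≤ k → c (a *ℕ b) ≡ c a * c b

TotalColouring : (ℕ → ℤ) → Set
TotalColouring C = ∀ n → 1 ≤ n → IsColour (C n)

CompletelyMultiplicative : (ℕ → ℤ) → Set
CompletelyMultiplicative C = ∀ a b → 1 ≤ a → 1 ≤ b → C (a *ℕ b) ≡ C a * C b

-- The multiplicative extension is forced on primes ≤ k and free on primes > k; we give
-- those the colour +1 and extend along prime factorisations. Complete multiplicativity
-- then factors the dilated sum: ∑_{j ≤ k} C(js) = C(s) · ∑_{j ≤ k} c(j), and multiplying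
-- a value in {-1, 0, 1} by a colour ±1 stays in {-1, 0, 1}.
module Submission where

open import Defs
open import Data.Nat using (ℕ; zero; suc; _≤_; _*_; _≤?_; s≤s; z≤n; >-nonZero; >-nonZero⁻¹)
open import Data.Nat.Properties using (≤-refl; ≤-trans; n≤1+n; m≤m*n; m≤n*m)
open import Data.Nat.ListAction using (product)
open import Data.Nat.ListAction.Properties using (product-++)
open import Data.Nat.Primality using (Prime; prime⇒nonZero; productOfPrimes≥1)
open import Data.Nat.Primality.Factorisation using (PrimeFactorisation; factorise; factors; factorisationUnique)
open import Data.Integer using (ℤ; +_) renaming (_+_ to _+ℤ_; _*_ to _*ℤ_)
open import Data.Integer.Properties using (*-identityˡ; *-assoc; *-distribʳ-+; *-1-commutativeMonoid)
open import Data.List using (List; []; _∷_; _++_; map; foldr)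
open import Data.List.Properties using (map-++)
open import Data.List.Relation.Unary.All using (All; []; _∷_)
open import Data.List.Relation.Unary.All.Properties using (++⁺)
open import Data.List.Relation.Binary.Permutation.Propositional using (_↭_; ↭⇒↭ₛ)
open import Data.List.Relation.Binary.Permutation.Propositional.Properties using (map⁺)
open import Data.List.Relation.Binary.Permutation.Setoid.Properties using (foldr-commMonoid)
open import Algebra.Bundles using (CommutativeMonoid)
open import Data.Product using (Σ; _×_; _,_)
open import Data.Sum using (inj₁; inj₂)
open import Relation.Nullary using (yes; no; contradiction)
open import Relation.Binary.PropositionalEquality
  using (_≡_; refl; sym; trans; cong; cong₂; subst; module ≡-Reasoning)

isColour-* : ∀ {x y} → IsColour x → IsColour y → IsColour (x *ℤ y)
isColour-* (inj₁ refl) (inj₁ refl) = inj₁ refl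
isColour-* (inj₁ refl) (inj₂ refl) = inj₂ refl
isColour-* (inj₂ refl) (inj₁ refl) = inj₂ refl
isColour-* (inj₂ refl) (inj₂ refl) = inj₁ refl

inMinusOneZeroOne-* : ∀ {x y} → InMinusOneZeroOne x → IsColour y → InMinusOneZeroOne (x *ℤ y)
inMinusOneZeroOne-* (inj₁ refl)        (inj₁ refl) = inj₁ refl
inMinusOneZeroOne-* (inj₁ refl)        (inj₂ refl) = inj₂ (inj₂ refl)
inMinusOneZeroOne-* (inj₂ (inj₁ refl)) (inj₁ refl) = inj₂ (inj₁ refl)
inMinusOneZeroOne-* (inj₂ (inj₁ refl)) (inj₂ refl) = inj₂ (inj₁ refl)
inMinusOneZeroOne-* (inj₂ (inj₂ refl)) (inj₁ refl) = inj₂ (inj₂ refl)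
inMinusOneZeroOne-* (inj₂ (inj₂ refl)) (inj₂ refl) = inj₁ refl

sumTo-cong : ∀ {f g : ℕ → ℤ} k → (∀ j → 1 ≤ j → j ≤ k → f j ≡ g j) → sumTo f k ≡ sumTo g k
sumTo-cong zero    f≗g = refl
sumTo-cong (suc k) f≗g =
  cong₂ _+ℤ_ (sumTo-cong k (λ j 1≤j j≤k → f≗g j 1≤j (≤-trans j≤k (n≤1+n k))))
             (f≗g (suc k) (s≤s z≤n) ≤-refl)

sumTo-*ʳ : ∀ (f : ℕ → ℤ) y k → sumTo (λ j → f j *ℤ y) k ≡ sumTo f k *ℤ y
sumTo-*ʳ f y zero    = refl
sumTo-*ʳ f y (suc k) = trans (cong (_+ℤ f (suc k) *ℤ y) (sumTo-*ʳ f y k))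
                             (sym (*-distribʳ-+ y (sumTo f k) (f (suc k))))

productℤ : List ℤ → ℤ
productℤ = foldr _*ℤ_ (+ 1)

productℤ-++ : ∀ xs ys → productℤ (xs ++ ys) ≡ productℤ xs *ℤ productℤ ys
productℤ-++ []       ys = sym (*-identityˡ (productℤ ys))
productℤ-++ (x ∷ xs) ys = trans (cong (x *ℤ_) (productℤ-++ xs ys)) (sym (*-assoc x _ _))

productℤ-↭ : ∀ {xs ys} → xs ↭ ys → productℤ xs ≡ productℤ ys
productℤ-↭ p = foldr-commMonoid ℤ-*-1.setoid ℤ-*-1.isCommutativeMonoid (↭⇒↭ₛ p)
  where module ℤ-*-1 = CommutativeMonoid *-1-commutativeMonoid

productℤ-isColour : ∀ {xs} → All IsColour xs → IsColour (productℤ xs)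
productℤ-isColour []       = inj₁ refl
productℤ-isColour (x ∷ xs) = isColour-* x (productℤ-isColour xs)

prime≥1 : ∀ {p} → Prime p → 1 ≤ p
prime≥1 {p} pp = >-nonZero⁻¹ p {{prime⇒nonZero pp}}

factorisation-* : ∀ {m n} → PrimeFactorisation m → PrimeFactorisation n → PrimeFactorisation (m * n)
factorisation-* F G = record
  { factors         = factors F ++ factors G
  ; isFactorisation = trans (cong₂ _*_ (isFactorisation F) (isFactorisation G))
                            (sym (product-++ (factors F) (factors G)))
  ; factorsPrime    = ++⁺ (factorsPrime F) (factorsPrime G)
  }
  where open PrimeFactorisation

-- The value at 0 is junk: ℕ = {1, 2, …} here.
multiplicativeExtension : (ℕ → ℤ) → ℕ → ℤ
multiplicativeExtension f zero      = + 1
multiplicativeExtension f n@(suc _) = productℤ (map f (factors (factorise n)))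

module _ (f : ℕ → ℤ) where

  private
    F̂ : ℕ → ℤ
    F̂ = multiplicativeExtension f

  multiplicativeExtension-factors : ∀ {n} (F : PrimeFactorisation (suc n)) →
    F̂ (suc n) ≡ productℤ (map f (factors F))
  multiplicativeExtension-factors F = productℤ-↭ (map⁺ f (factorisationUnique (factorise _) F))

  multiplicativeExtension-completelyMultiplicative : CompletelyMultiplicative F̂
  multiplicativeExtension-completelyMultiplicative (suc a) (suc b) _ _ = begin
    F̂ (suc a * suc b)                                   ≡⟨ multiplicativeExtension-factors (factorisation-* Fa Fb) ⟩
    productℤ (map f (factors Fa ++ factors Fb))         ≡⟨ cong productℤ (map-++ f (factors Fa) (factors Fb)) ⟩
    productℤ (map f (factors Fa) ++ map f (factors Fb)) ≡⟨ productℤ-++ (map f (factors Fa)) _ ⟩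
    F̂ (suc a) *ℤ F̂ (suc b)                              ∎
    where
      open ≡-Reasoning
      Fa : PrimeFactorisation (suc a)
      Fa = factorise (suc a)
      Fb : PrimeFactorisation (suc b)
      Fb = factorise (suc b)

  multiplicativeExtension-totalColouring : (∀ p → Prime p → IsColour (f p)) → TotalColouring F̂
  multiplicativeExtension-totalColouring f-colour (suc n) _ =
    productℤ-isColour (colours (PrimeFactorisation.factorsPrime (factorise (suc n))))
    where
      colours : ∀ {ps} → All Prime ps → All IsColour (map f ps)
      colours []         = []
      colours (pp ∷ pps) = f-colour _ pp ∷ colours pps

  module _ {k : ℕ} {g : ℕ → ℤ} (g1 : g 1 ≡ + 1) (g-mul : MultiplicativeUpTo k g)
           (f≗g : ∀ p → Prime p → p ≤ k → f p ≡ g p) where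

    productℤ-map-agrees : ∀ {ps} → All Prime ps → product ps ≤ k → productℤ (map f ps) ≡ g (product ps)
    productℤ-map-agrees []                 _   = sym g1
    productℤ-map-agrees {p ∷ ps} (pp ∷ pps) Π≤k = begin
      f p *ℤ productℤ (map f ps) ≡⟨ cong₂ _*ℤ_ (f≗g p pp p≤k) (productℤ-map-agrees pps Πps≤k) ⟩
      g p *ℤ g (product ps)      ≡⟨ sym (g-mul p (product ps) (prime≥1 pp) Πps≥1 Π≤k) ⟩
      g (p * product ps)         ∎
      where
        open ≡-Reasoning
        Πps≥1 : 1 ≤ product ps
        Πps≥1 = productOfPrimes≥1 pps
        p≤k : p ≤ k
        p≤k = ≤-trans (m≤m*n p (product ps) {{>-nonZero Πps≥1}}) Π≤k
        Πps≤k : product ps ≤ k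
        Πps≤k = ≤-trans (m≤n*m (product ps) p {{prime⇒nonZero pp}}) Π≤k

    multiplicativeExtension-agrees : ∀ n → 1 ≤ n → n ≤ k → F̂ n ≡ g n
    multiplicativeExtension-agrees (suc n) _ n≤k =
      trans (productℤ-map-agrees factorsPrime (subst (_≤ k) isFactorisation n≤k))
            (cong g (sym isFactorisation))
      where open PrimeFactorisation (factorise (suc n))

truncate : ℕ → (ℕ → ℤ) → ℕ → ℤ
truncate k c n with n ≤? k
... | yes _ = c n
... | no  _ = + 1

truncate-≤ : ∀ k c n → n ≤ k → truncate k c n ≡ c n
truncate-≤ k c n n≤k with n ≤? k
... | yes _   = refl
... | no  n≰k = contradiction n≤k n≰k

truncate-isColour : ∀ {k c} → PartialColouring k c → ∀ n → 1 ≤ n → IsColour (truncate k c n)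
truncate-isColour {k} col n 1≤n with n ≤? k
... | yes n≤k = col n 1≤n n≤k
... | no  _   = inj₁ refl

partialColouring-one : ∀ {k c} → 1 ≤ k → PartialColouring k c → MultiplicativeUpTo k c → c 1 ≡ + 1
partialColouring-one 1≤k col mul with col 1 ≤-refl 1≤k
... | inj₁ c1≡1 = c1≡1
... | inj₂ c1≡-1 with trans (sym c1≡-1) (trans (mul 1 1 ≤-refl ≤-refl 1≤k) (cong₂ _*ℤ_ c1≡-1 c1≡-1))
...   | ()

sumTo-dilation : ∀ {C c : ℕ → ℤ} k → CompletelyMultiplicative C → (∀ a → 1 ≤ a → a ≤ k → C a ≡ c a) →
  ∀ s → 1 ≤ s → sumTo (λ j → C (j * s)) k ≡ sumTo c k *ℤ C s
sumTo-dilation {C} {c} k C-mul C≗c s 1≤s = begin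
  sumTo (λ j → C (j * s)) k    ≡⟨ sumTo-cong k (λ j 1≤j _ → C-mul j s 1≤j 1≤s) ⟩
  sumTo (λ j → C j *ℤ C s) k   ≡⟨ sumTo-*ʳ C (C s) k ⟩
  sumTo C k *ℤ C s             ≡⟨ cong (_*ℤ C s) (sumTo-cong k C≗c) ⟩
  sumTo c k *ℤ C s             ∎
  where open ≡-Reasoning

lemma1 : (k : ℕ) → 1 ≤ k → (c : ℕ → ℤ) →
    PartialColouring k c → MultiplicativeUpTo k c → PerfectlyBalanced c k →
    Σ (ℕ → ℤ) (λ C →
      TotalColouring C × CompletelyMultiplicative C ×
      (∀ a → 1 ≤ a → a ≤ k → C a ≡ c a) ×
      (∀ s → 1 ≤ s → PerfectlyBalanced (λ j → C (j * s)) k))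
lemma1 k 1≤k c col mul bal = C , C-colour , C-mul , C≗c , balanced
  where
    h : ℕ → ℤ
    h = truncate k c
    C : ℕ → ℤ
    C = multiplicativeExtension h
    C-colour : TotalColouring C
    C-colour = multiplicativeExtension-totalColouring h (λ p pp → truncate-isColour col p (prime≥1 pp))
    C-mul : CompletelyMultiplicative C
    C-mul = multiplicativeExtension-completelyMultiplicative h
    C≗c : ∀ a → 1 ≤ a → a ≤ k → C a ≡ c a
    C≗c = multiplicativeExtension-agrees h (partialColouring-one 1≤k col mul) mul
            (λ p _ → truncate-≤ k c p)
    balanced : ∀ s → 1 ≤ s → PerfectlyBalanced (λ j → C (j * s)) k
    balanced s 1≤s = subst InMinusOneZeroOne (sym (sumTo-dilation k C-mul C≗c s 1≤s))
                           (inMinusOneZeroOne-* bal (C-colour s 1≤s))
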